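{- Let $G$ be an always solvable finite simple graph of order $n$. Then every odd dominating set of $G$ has odd cardinality if $n$ is odd, and even cardinality if $n$ is even.
   Context: For a vertex $u$ of a finite simple graph $G$, $N[u]=\{w\in V(G) : w \text{ adjacent to } u \text{ or } w=u\}$. A set $S\subseteq V(G)$ is an odd dominating set if $|N[u]\cap S|$ is odd for every $u\in V(G)$. For $C\subseteq V(G)$, a set $S$ is a $C$-parity set if $|N[u]\cap S|$ is odd for all $u\in C$ and even for all $u\notin C$. $G$ is always solvable if a $C$-parity set exists for every $C\subseteq V(G)$ (equivalently, the closed neighborhood matrix $N(G)$, i.e. adjacency matrix plus identity, is invertible over $\mathbb{Z}_2$). -}

module Defs where

open import Data.Nat using (ℕ; _%_)
open import Data.Bool using (Bool; true; false; _∨_)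
open import Data.Fin using (Fin; _≟_)
open import Data.Fin.Subset using (Subset; _∩_; ∣_∣; _∈_; _∉_)
open import Data.Vec using (tabulate)
open import Data.Product using (Σ; _×_)
open import Relation.Binary.PropositionalEquality using (_≡_; _≢_)
open import Relation.Nullary.Decidable using (⌊_⌋)

record Graph (n : ℕ) : Set where
  field
    adj    : Fin n → Fin n → Bool
    sym    : ∀ u v → adj u v ≡ adj v u
    irrefl : ∀ u → adj u u ≡ false
open Graph public

N[_]_ : ∀ {n} → Graph n → Fin n → Subset n
N[ G ] u = tabulate (λ w → ⌊ u ≟ w ⌋ ∨ adj G u w)

IsOdd : ℕ → Set
IsOdd k = k % 2 ≡ 1

IsEven : ℕ → Set
IsEven k = k % 2 ≡ 0

OddDominating : ∀ {n} → Graph n → Subset n → Set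
OddDominating G S = ∀ u → IsOdd ∣ (N[ G ] u) ∩ S ∣

CParity : ∀ {n} → Graph n → Subset n → Subset n → Set
CParity G C S =
  (∀ u → u ∈ C → IsOdd ∣ (N[ G ] u) ∩ S ∣) ×
  (∀ u → u ∉ C → IsEven ∣ (N[ G ] u) ∩ S ∣)

AlwaysSolvable : ∀ {n} → Graph n → Set
AlwaysSolvable {n} G = ∀ (C : Subset n) → Σ (Subset n) (CParity G C)

{-# OPTIONS --safe #-}
-- Over GF(2) the indicator vector s of S turns "always solvable" into surjectivity of the
-- symmetric closed neighbourhood matrix N, and "odd dominating" into N s = 1 = diag N, while
-- |S| ≡ diag N · s. So it suffices that diag M · w ≡ n (mod 2) whenever M is symmetric and
-- invertible and M w = diag M. This follows by symmetric Gaussian elimination: pivoting on some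
-- M i i = 1 (Schur complement M' = M − a aᵀ) keeps the hypotheses for w with its i-th entry
-- deleted and flips diag · w; if the diagonal vanishes, some M 0 j = 1, and pivoting on the block
-- {0, j} (M' = M − α βᵀ − β αᵀ) keeps diag · w while n drops by 2.
module Submission where

open import Defs hiding (sym)
open import Algebra.Bundles using (CommutativeRing)
open import Data.Bool using (Bool; true; false; not; _∧_; _∨_; _xor_; if_then_else_)
open import Data.Bool.Properties as Bool
  using ( xor-∧-commutativeRing; ∧-comm; ∧-assoc; ∧-idem; ∧-identityʳ; ∧-zeroʳ; ∧-distribʳ-xor
        ; xor-identityʳ; not-involutive; ¬-not)
open import Data.Bool.Solver using (module xor-∧-Solver)
open import Data.Fin using (Fin; zero; suc; punchIn; _≟_)
open import Data.Fin.Properties using (any?)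
open import Data.Fin.Subset using (Subset; _∩_; ∣_∣)
open import Data.Nat using (ℕ; zero; suc; _%_)
open import Data.Product using (_×_; _,_; ∃-syntax)
open import Data.Vec using ([]; _∷_; lookup; tabulate)
open import Data.Vec.Functional using (Vector; removeAt; insertAt; tail)
open import Data.Vec.Functional.Properties using (insertAt-lookup; insertAt-punchIn)
open import Data.Vec.Properties using (lookup-zipWith; lookup∘tabulate; []=⇒lookup; lookup⇒[]=)
open import Function using (_∘_)
open import Relation.Binary.PropositionalEquality
  using (_≡_; _≗_; refl; sym; trans; cong; cong₂; module ≡-Reasoning)
open import Relation.Nullary using (¬_; yes; no; contradiction)
open import Relation.Nullary.Decidable using (⌊_⌋; isYes≗does; dec-true)

open import Algebra.Properties.Semiring.Sum (CommutativeRing.semiring xor-∧-commutativeRing)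
  using (sum; sum-remove; sum-cong-≗; ∑-distrib-+; *-distribˡ-sum)

-- This solver normalises with coefficients in Bool itself, so it also knows 1 + 1 = 0.
open xor-∧-Solver using (solve; _:=_; _:+_; _:*_; con)
open ≡-Reasoning

Matrix : ℕ → Set
Matrix n = Fin n → Fin n → Bool

infix 7 _∙_
_∙_ : ∀ {n} → Vector Bool n → Vector Bool n → Bool
u ∙ v = sum (λ k → u k ∧ v k)

infixr 8 _*ᵥ_
_*ᵥ_ : ∀ {n} → Matrix n → Vector Bool n → Vector Bool n
(M *ᵥ x) i = M i ∙ x

diagonal : ∀ {n} → Matrix n → Vector Bool n
diagonal M i = M i i

Symmetric : ∀ {n} → Matrix n → Set
Symmetric M = ∀ i j → M i j ≡ M j i

Surjective : ∀ {n} → Matrix n → Set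
Surjective {n} M = ∀ (c : Vector Bool n) → ∃[ x ] M *ᵥ x ≗ c

parity : ℕ → Bool
parity zero    = false
parity (suc n) = not (parity n)

∙-removeAt : ∀ {n} (u v : Vector Bool (suc n)) i →
             u ∙ v ≡ (u i ∧ v i) xor (removeAt u i ∙ removeAt v i)
∙-removeAt u v i = sum-remove {i = i} (λ k → u k ∧ v k)

∙-rank-one : ∀ {n} (u v y : Vector Bool n) b →
             (λ k → u k xor (b ∧ v k)) ∙ y ≡ u ∙ y xor (b ∧ v ∙ y)
∙-rank-one u v y b = begin
  sum (λ k → (u k xor (b ∧ v k)) ∧ y k)
    ≡⟨ sum-cong-≗ (λ k → trans (∧-distribʳ-xor (y k) (u k) _)
                                (cong ((u k ∧ y k) xor_) (∧-assoc b (v k) (y k)))) ⟩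
  sum (λ k → (u k ∧ y k) xor (b ∧ (v k ∧ y k)))
    ≡⟨ ∑-distrib-+ (λ k → u k ∧ y k) (λ k → b ∧ (v k ∧ y k)) ⟩
  u ∙ y xor sum (λ k → b ∧ (v k ∧ y k))
    ≡⟨ cong (u ∙ y xor_) (sym (*-distribˡ-sum b (λ k → v k ∧ y k))) ⟩
  u ∙ y xor (b ∧ v ∙ y) ∎

∙≡true⇒nonzero : ∀ {n} (u v : Vector Bool n) → u ∙ v ≡ true → ∃[ k ] u k ≡ true
∙≡true⇒nonzero {zero}  u v ()
∙≡true⇒nonzero {suc n} u v uv≡true with u zero in u₀
... | true  = zero , u₀
... | false with ∙≡true⇒nonzero (tail u) (tail v) uv≡true
...   | k , uₖ = suc k , uₖ

module DiagonalPivot {n} (M : Matrix (suc n)) (M-sym : Symmetric M)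
                     (i : Fin (suc n)) (Mᵢᵢ : M i i ≡ true) where

  a : Vector Bool n
  a = removeAt (M i) i

  schur : Matrix n
  schur j k = M (punchIn i j) (punchIn i k) xor (a j ∧ a k)

  schur-symmetric : Symmetric schur
  schur-symmetric j k = cong₂ _xor_ (M-sym _ _) (∧-comm (a j) (a k))

  row-pivot : ∀ x → (M *ᵥ x) i ≡ x i xor a ∙ removeAt x i
  row-pivot x = trans (∙-removeAt (M i) x i) (cong (λ m → (m ∧ x i) xor a ∙ removeAt x i) Mᵢᵢ)

  schur-*ᵥ : ∀ x j →
             (schur *ᵥ removeAt x i) j ≡ (M *ᵥ x) (punchIn i j) xor (a j ∧ (M *ᵥ x) i)
  schur-*ᵥ x j = begin
    (schur *ᵥ y) j
      ≡⟨ ∙-rank-one (removeAt (M (punchIn i j)) i) a y (a j) ⟩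
    U xor (a j ∧ a ∙ y)
      ≡⟨ solve 4 (λ U a x T → U :+ (a :* T) := ((a :* x) :+ U) :+ (a :* (x :+ T)))
               refl U (a j) (x i) (a ∙ y) ⟩
    ((a j ∧ x i) xor U) xor (a j ∧ (x i xor a ∙ y))
      ≡⟨ cong₂ (λ r s → r xor (a j ∧ s)) (sym row-punchIn) (sym (row-pivot x)) ⟩
    (M *ᵥ x) (punchIn i j) xor (a j ∧ (M *ᵥ x) i) ∎
    where
    y = removeAt x i
    U = removeAt (M (punchIn i j)) i ∙ y
    row-punchIn : (M *ᵥ x) (punchIn i j) ≡ (a j ∧ x i) xor U
    row-punchIn = trans (∙-removeAt (M (punchIn i j)) x i)
                        (cong (λ m → (m ∧ x i) xor U) (M-sym (punchIn i j) i))

  schur-surjective : Surjective M → Surjective schur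
  schur-surjective surj c with surj (insertAt c i false)
  ... | x , Mx≗c = removeAt x i , λ j → begin
    (schur *ᵥ removeAt x i) j
      ≡⟨ schur-*ᵥ x j ⟩
    (M *ᵥ x) (punchIn i j) xor (a j ∧ (M *ᵥ x) i)
      ≡⟨ cong₂ (λ r s → r xor (a j ∧ s)) (Mx≗c (punchIn i j)) (Mx≗c i) ⟩
    insertAt c i false (punchIn i j) xor (a j ∧ insertAt c i false i)
      ≡⟨ cong₂ (λ r s → r xor (a j ∧ s))
               (insertAt-punchIn c i false j) (insertAt-lookup c i false) ⟩
    c j xor (a j ∧ false)
      ≡⟨ trans (cong (c j xor_) (∧-zeroʳ (a j))) (xor-identityʳ (c j)) ⟩
    c j ∎

  schur-diagonal : ∀ w → M *ᵥ w ≗ diagonal M → schur *ᵥ removeAt w i ≗ diagonal schur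
  schur-diagonal w Mw≗d j = begin
    (schur *ᵥ removeAt w i) j
      ≡⟨ schur-*ᵥ w j ⟩
    (M *ᵥ w) (punchIn i j) xor (a j ∧ (M *ᵥ w) i)
      ≡⟨ cong₂ (λ r s → r xor (a j ∧ s)) (Mw≗d (punchIn i j)) (trans (Mw≗d i) Mᵢᵢ) ⟩
    M (punchIn i j) (punchIn i j) xor (a j ∧ true)
      ≡⟨ cong (M (punchIn i j) (punchIn i j) xor_)
              (trans (∧-identityʳ (a j)) (sym (∧-idem (a j)))) ⟩
    schur j j ∎

  diagonal∙-schur : ∀ w → M *ᵥ w ≗ diagonal M →
                    diagonal M ∙ w ≡ not (diagonal schur ∙ removeAt w i)
  diagonal∙-schur w Mw≗d = begin
    diagonal M ∙ w
      ≡⟨ trans (∙-removeAt (diagonal M) w i) (cong (λ m → (m ∧ w i) xor D) Mᵢᵢ) ⟩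
    w i xor D
      ≡⟨ solve 3 (λ x D T → x :+ D := (x :+ T) :+ (D :+ T)) refl (w i) D (a ∙ y) ⟩
    (w i xor a ∙ y) xor (D xor a ∙ y)
      ≡⟨ cong₂ _xor_ (trans (sym (row-pivot w)) (trans (Mw≗d i) Mᵢᵢ))
                     (cong (D xor_) (sym aa∙y≡a∙y)) ⟩
    true xor (D xor (λ k → a k ∧ a k) ∙ y)
      ≡⟨ cong not (sym (∙-rank-one (removeAt (diagonal M) i) (λ k → a k ∧ a k) y true)) ⟩
    not (diagonal schur ∙ y) ∎
    where
    y = removeAt w i
    D = removeAt (diagonal M) i ∙ y
    aa∙y≡a∙y : (λ k → a k ∧ a k) ∙ y ≡ a ∙ y
    aa∙y≡a∙y = sum-cong-≗ (λ k → cong (_∧ y k) (∧-idem (a k)))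

module HyperbolicPivot {n} (M : Matrix (suc (suc n))) (M-sym : Symmetric M)
                       (j : Fin (suc n)) (M₀₀ : M zero zero ≡ false)
                       (Mⱼⱼ : M (suc j) (suc j) ≡ false) (M₀ⱼ : M zero (suc j) ≡ true) where

  restrict : Vector Bool (suc (suc n)) → Vector Bool n
  restrict x = removeAt (tail x) j

  p : Fin n → Fin (suc (suc n))
  p = suc ∘ punchIn j

  α β : Vector Bool n
  α = restrict (M zero)
  β = restrict (M (suc j))

  schur : Matrix n
  schur k l = (M (p k) (p l) xor (α k ∧ β l)) xor (β k ∧ α l)

  ∙-restrict : ∀ (u v : Vector Bool (suc (suc n))) →
               u ∙ v ≡ (u zero ∧ v zero) xor ((u (suc j) ∧ v (suc j)) xor (restrict u ∙ restrict v))
  ∙-restrict u v = cong ((u zero ∧ v zero) xor_) (∙-removeAt (tail u) (tail v) j)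

  schur-symmetric : Symmetric schur
  schur-symmetric k l = begin
    (M (p k) (p l) xor (α k ∧ β l)) xor (β k ∧ α l)
      ≡⟨ cong (λ m → (m xor (α k ∧ β l)) xor (β k ∧ α l)) (M-sym (p k) (p l)) ⟩
    (M (p l) (p k) xor (α k ∧ β l)) xor (β k ∧ α l)
      ≡⟨ solve 5 (λ m a b c d → (m :+ (a :* b)) :+ (c :* d) := (m :+ (d :* c)) :+ (b :* a)) refl
               (M (p l) (p k)) (α k) (β l) (β k) (α l) ⟩
    (M (p l) (p k) xor (α l ∧ β k)) xor (β l ∧ α k) ∎

  schur-*ᵥ : ∀ x k → (schur *ᵥ restrict x) k ≡
             ((M *ᵥ x) (p k) xor (α k ∧ (M *ᵥ x) (suc j))) xor (β k ∧ (M *ᵥ x) zero)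
  schur-*ᵥ x k = begin
    (schur *ᵥ y) k
      ≡⟨ ∙-rank-one (λ l → M (p k) (p l) xor (α k ∧ β l)) α y (β k) ⟩
    (λ l → M (p k) (p l) xor (α k ∧ β l)) ∙ y xor (β k ∧ α ∙ y)
      ≡⟨ cong (_xor (β k ∧ α ∙ y)) (∙-rank-one (restrict (M (p k))) β y (α k)) ⟩
    (U xor (α k ∧ β ∙ y)) xor (β k ∧ α ∙ y)
      ≡⟨ solve 7 (λ U a b A B x₀ xⱼ → (U :+ (a :* B)) :+ (b :* A)
                    := (((a :* x₀) :+ ((b :* xⱼ) :+ U)) :+ (a :* (x₀ :+ B))) :+ (b :* (xⱼ :+ A)))
               refl U (α k) (β k) (α ∙ y) (β ∙ y) (x zero) (x (suc j)) ⟩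
    (((α k ∧ x zero) xor ((β k ∧ x (suc j)) xor U)) xor (α k ∧ (x zero xor β ∙ y)))
      xor (β k ∧ (x (suc j) xor α ∙ y))
      ≡⟨ cong₂ (λ r s → r xor (β k ∧ s))
               (cong₂ (λ r s → r xor (α k ∧ s)) (sym row-p) (sym row-j)) (sym row-0) ⟩
    ((M *ᵥ x) (p k) xor (α k ∧ (M *ᵥ x) (suc j))) xor (β k ∧ (M *ᵥ x) zero) ∎
    where
    y = restrict x
    U = restrict (M (p k)) ∙ y
    row-p : (M *ᵥ x) (p k) ≡ (α k ∧ x zero) xor ((β k ∧ x (suc j)) xor U)
    row-p = trans (∙-restrict (M (p k)) x)
                  (cong₂ (λ m m′ → (m ∧ x zero) xor ((m′ ∧ x (suc j)) xor U))
                         (M-sym (p k) zero) (M-sym (p k) (suc j)))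
    row-j : (M *ᵥ x) (suc j) ≡ x zero xor β ∙ y
    row-j = trans (∙-restrict (M (suc j)) x)
                  (cong₂ (λ m m′ → (m ∧ x zero) xor ((m′ ∧ x (suc j)) xor β ∙ y))
                         (trans (M-sym (suc j) zero) M₀ⱼ) Mⱼⱼ)
    row-0 : (M *ᵥ x) zero ≡ x (suc j) xor α ∙ y
    row-0 = trans (∙-restrict (M zero) x)
                  (cong₂ (λ m m′ → (m ∧ x zero) xor ((m′ ∧ x (suc j)) xor α ∙ y)) M₀₀ M₀ⱼ)

  schur-surjective : Surjective M → Surjective schur
  schur-surjective surj c with surj (insertAt (insertAt c j false) zero false)
  ... | x , Mx≗c = restrict x , λ k → begin
    (schur *ᵥ restrict x) k
      ≡⟨ schur-*ᵥ x k ⟩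
    ((M *ᵥ x) (p k) xor (α k ∧ (M *ᵥ x) (suc j))) xor (β k ∧ (M *ᵥ x) zero)
      ≡⟨ cong₂ (λ r s → r xor (β k ∧ s))
               (cong₂ (λ r s → r xor (α k ∧ s))
                      (trans (Mx≗c (p k)) (insertAt-punchIn c j false k))
                      (trans (Mx≗c (suc j)) (insertAt-lookup c j false)))
               (Mx≗c zero) ⟩
    (c k xor (α k ∧ false)) xor (β k ∧ false)
      ≡⟨ solve 3 (λ c a b → (c :+ (a :* con false)) :+ (b :* con false) := c)
               refl (c k) (α k) (β k) ⟩
    c k ∎

  diagonal-schur : diagonal schur ≗ restrict (diagonal M)
  diagonal-schur k =
    solve 3 (λ m a b → (m :+ (a :* b)) :+ (b :* a) := m) refl (M (p k) (p k)) (α k) (β k)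

  schur-diagonal : ∀ w → M *ᵥ w ≗ diagonal M → schur *ᵥ restrict w ≗ diagonal schur
  schur-diagonal w Mw≗d k = begin
    (schur *ᵥ restrict w) k
      ≡⟨ schur-*ᵥ w k ⟩
    ((M *ᵥ w) (p k) xor (α k ∧ (M *ᵥ w) (suc j))) xor (β k ∧ (M *ᵥ w) zero)
      ≡⟨ cong₂ (λ r s → r xor (β k ∧ s))
               (cong₂ (λ r s → r xor (α k ∧ s)) (Mw≗d (p k)) (trans (Mw≗d (suc j)) Mⱼⱼ))
               (trans (Mw≗d zero) M₀₀) ⟩
    (M (p k) (p k) xor (α k ∧ false)) xor (β k ∧ false)
      ≡⟨ solve 3 (λ m a b → (m :+ (a :* con false)) :+ (b :* con false) := m)
               refl (M (p k) (p k)) (α k) (β k) ⟩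
    M (p k) (p k)
      ≡⟨ diagonal-schur k ⟨
    diagonal schur k ∎

  diagonal∙-schur : ∀ w → diagonal M ∙ w ≡ diagonal schur ∙ restrict w
  diagonal∙-schur w = begin
    diagonal M ∙ w
      ≡⟨ ∙-restrict (diagonal M) w ⟩
    (M zero zero ∧ w zero) xor ((M (suc j) (suc j) ∧ w (suc j)) xor D)
      ≡⟨ cong₂ (λ m m′ → (m ∧ w zero) xor ((m′ ∧ w (suc j)) xor D)) M₀₀ Mⱼⱼ ⟩
    D
      ≡⟨ sum-cong-≗ (λ k → cong (_∧ restrict w k) (diagonal-schur k)) ⟨
    diagonal schur ∙ restrict w ∎
    where D = restrict (diagonal M) ∙ restrict w

zero-diagonal : ∀ {n} (M : Matrix n) → ¬ (∃[ i ] M i i ≡ true) → ∀ i → M i i ≡ false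
zero-diagonal M ¬Mᵢᵢ i = ¬-not (λ Mᵢᵢ → ¬Mᵢᵢ (i , Mᵢᵢ))

first-row-partner : ∀ {n} (M : Matrix (suc n)) → Surjective M → M zero zero ≡ false →
                    ∃[ j ] M zero (suc j) ≡ true
first-row-partner M surj M₀₀ with surj (λ _ → true)
... | x , Mx≗1 with ∙≡true⇒nonzero (M zero) x (Mx≗1 zero)
...   | zero  , M₀₀≡true = contradiction (trans (sym M₀₀) M₀₀≡true) λ ()
...   | suc j , M₀ⱼ      = j , M₀ⱼ

diagonal∙solution≡parity : ∀ n (M : Matrix n) (w : Vector Bool n) →
                           Symmetric M → Surjective M → M *ᵥ w ≗ diagonal M →
                           diagonal M ∙ w ≡ parity n
diagonal∙solution≡parity zero _ _ _ _ _ = refl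
diagonal∙solution≡parity (suc n) M w M-sym surj Mw≗d with any? (λ i → M i i Bool.≟ true)
... | yes (i , Mᵢᵢ) =
  trans (diagonal∙-schur w Mw≗d)
        (cong not (diagonal∙solution≡parity n schur (removeAt w i)
                     schur-symmetric (schur-surjective surj) (schur-diagonal w Mw≗d)))
  where open DiagonalPivot M M-sym i Mᵢᵢ
... | no ¬Mᵢᵢ with first-row-partner M surj (zero-diagonal M ¬Mᵢᵢ zero)
diagonal∙solution≡parity (suc (suc n)) M w M-sym surj Mw≗d | no ¬Mᵢᵢ | j , M₀ⱼ =
  trans (diagonal∙-schur w)
        (trans (diagonal∙solution≡parity n schur (restrict w)
                  schur-symmetric (schur-surjective surj) (schur-diagonal w Mw≗d))
               (sym (not-involutive (parity n))))
  where open HyperbolicPivot M M-sym j (zero-diagonal M ¬Mᵢᵢ zero)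
                                       (zero-diagonal M ¬Mᵢᵢ (suc j)) M₀ⱼ

parity-size : ∀ {n} (p : Subset n) → parity ∣ p ∣ ≡ sum (lookup p)
parity-size []          = refl
parity-size (true ∷ p)  = cong not (parity-size p)
parity-size (false ∷ p) = parity-size p

%2≡parity : ∀ k → k % 2 ≡ (if parity k then 1 else 0)
%2≡parity zero          = refl
%2≡parity (suc zero)    = refl
%2≡parity (suc (suc k)) =
  trans (%2≡parity k) (cong (if_then 1 else 0) (sym (not-involutive (parity k))))

odd⇒parity≡true : ∀ k → IsOdd k → parity k ≡ true
odd⇒parity≡true k k%2≡1 with parity k | %2≡parity k
... | true  | _      = refl
... | false | k%2≡0 = contradiction (trans (sym k%2≡1) k%2≡0) λ ()

even⇒parity≡false : ∀ k → IsEven k → parity k ≡ false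
even⇒parity≡false k k%2≡0 with parity k | %2≡parity k
... | false | _      = refl
... | true  | k%2≡1 = contradiction (trans (sym k%2≡0) k%2≡1) λ ()

module _ {n} (G : Graph n) where

  closedNeighbourhoodMatrix : Matrix n
  closedNeighbourhoodMatrix u = lookup (N[ G ] u)

  private
    N = closedNeighbourhoodMatrix

  N-entry : ∀ u w → N u w ≡ ⌊ u ≟ w ⌋ ∨ adj G u w
  N-entry u = lookup∘tabulate (λ w → ⌊ u ≟ w ⌋ ∨ adj G u w)

  N-symmetric : Symmetric N
  N-symmetric u w = begin
    N u w                        ≡⟨ N-entry u w ⟩
    ⌊ u ≟ w ⌋ ∨ adj G u w        ≡⟨ cong₂ _∨_ (≟-sym u w) (Graph.sym G u w) ⟩
    ⌊ w ≟ u ⌋ ∨ adj G w u        ≡⟨ N-entry w u ⟨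
    N w u                        ∎
    where
    ≟-sym : ∀ u w → ⌊ u ≟ w ⌋ ≡ ⌊ w ≟ u ⌋
    ≟-sym u w with u ≟ w | w ≟ u
    ... | yes _   | yes _   = refl
    ... | no _    | no _    = refl
    ... | yes u≡w | no w≢u  = contradiction (sym u≡w) w≢u
    ... | no u≢w  | yes w≡u = contradiction (sym w≡u) u≢w

  N-diagonal : ∀ u → N u u ≡ true
  N-diagonal u =
    trans (N-entry u u) (cong (_∨ adj G u u) (trans (isYes≗does (u ≟ u)) (dec-true (u ≟ u) refl)))

  parity-neighbourhood : ∀ S u → parity ∣ N[ G ] u ∩ S ∣ ≡ (N *ᵥ lookup S) u
  parity-neighbourhood S u =
    trans (parity-size (N[ G ] u ∩ S)) (sum-cong-≗ (λ w → lookup-zipWith _∧_ w (N[ G ] u) S))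

  N-surjective : AlwaysSolvable G → Surjective N
  N-surjective solvable c with solvable (tabulate c)
  ... | S , odd-on-C , even-off-C =
    lookup S , λ u → trans (sym (parity-neighbourhood S u)) (parity≡c u)
    where
    parity≡c : ∀ u → parity ∣ N[ G ] u ∩ S ∣ ≡ c u
    parity≡c u with c u in cᵤ
    ... | true  = odd⇒parity≡true ∣ N[ G ] u ∩ S ∣
                    (odd-on-C u (lookup⇒[]= u (tabulate c) (trans (lookup∘tabulate c u) cᵤ)))
    ... | false = even⇒parity≡false ∣ N[ G ] u ∩ S ∣ (even-off-C u λ u∈C →
                    contradiction (trans (sym cᵤ) (trans (sym (lookup∘tabulate c u)) ([]=⇒lookup u∈C)))
                                  λ ())

  odd-dominating⇒diagonal-solution : ∀ {S} → OddDominating G S → N *ᵥ lookup S ≗ diagonal N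
  odd-dominating⇒diagonal-solution {S} odd u =
    trans (sym (parity-neighbourhood S u))
          (trans (odd⇒parity≡true ∣ N[ G ] u ∩ S ∣ (odd u)) (sym (N-diagonal u)))

  odd-dominating-size-parity : AlwaysSolvable G → ∀ S → OddDominating G S →
                               parity ∣ S ∣ ≡ parity n
  odd-dominating-size-parity solvable S odd = begin
    parity ∣ S ∣                 ≡⟨ parity-size S ⟩
    sum (lookup S)               ≡⟨ sum-cong-≗ (λ u → cong (_∧ lookup S u) (N-diagonal u)) ⟨
    diagonal N ∙ lookup S        ≡⟨ diagonal∙solution≡parity n N (lookup S) N-symmetric
                                      (N-surjective solvable) (odd-dominating⇒diagonal-solution odd) ⟩
    parity n                     ∎

corollary3p1 : (n : ℕ) (G : Graph n) → AlwaysSolvable G →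
    (S : Subset n) → OddDominating G S →
    (IsOdd n → IsOdd ∣ S ∣) × (IsEven n → IsEven ∣ S ∣)
corollary3p1 n G solvable S odd = trans ∣S∣%2≡n%2 , trans ∣S∣%2≡n%2
  where
  ∣S∣%2≡n%2 : ∣ S ∣ % 2 ≡ n % 2
  ∣S∣%2≡n%2 = begin
    ∣ S ∣ % 2                       ≡⟨ %2≡parity ∣ S ∣ ⟩
    (if parity ∣ S ∣ then 1 else 0) ≡⟨ cong (if_then 1 else 0)
                                           (odd-dominating-size-parity G solvable S odd) ⟩
    (if parity n then 1 else 0)     ≡⟨ %2≡parity n ⟨
    n % 2                           ∎
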